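{- There is a register machine (addition machine) with four integer registers which, on input of an integer $x\geq 0$ with $n$ binary digits, outputs (in some order, each exactly once) all the powers of two $2^e$ occurring in the binary representation $x=\sum_{e\in E}2^e$ of $x$, and which runs in time $O(n)$.
   Context: Model (addition machine): a program is a finite list of numbered lines; the machine has finitely many registers, each holding an arbitrary integer. Allowed commands, each counting as one step, are: $x=y+z$, $x=y+k$, $x=y-z$, $x=y-k$, $x=k-y$, $x=k$ (for registers $x,y,z$, not necessarily distinct, and integer constants $k$); "read $x$" and "write $x$" (reading/writing a whole integer); "if $x\,R\,y$ then ... else ..." and "if $x\,R\,k$ then ... else ..." with $R\in\{<,=,>,\neq,\leq,\geq\}$; and "goto $\ell$" for a fixed line number $\ell$. Finitely many variables with a fixed finite range of values may also be used and do not count as registers. Running time is the number of executed commands. For example, for $x=13$ the machine outputs $8,4,1$ in some order. -}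

module Defs where

open import Data.Nat as ℕ using (ℕ; zero; suc; _^_)
open import Data.Nat.Logarithm using (⌊log₂_⌋)
open import Data.Integer as ℤ using (ℤ; +_)
open import Data.Integer.Properties as ℤP using ()
open import Data.Fin using (Fin; _≟_)
open import Data.Fin as Fin using ()
open import Data.List using (List; []; _∷_; map)
open import Data.Nat.ListAction using (sum)
open import Data.List.Relation.Unary.Unique.Propositional using (Unique)
open import Data.List.Relation.Binary.Permutation.Propositional using (_↭_)
open import Data.Maybe using (Maybe; just; nothing)
open import Data.Bool using (Bool; true; false; if_then_else_)
open import Data.Product using (Σ; _×_; _,_; ∃)
open import Relation.Nullary using (does)
open import Relation.Binary.PropositionalEquality using (_≡_)

-- Addition machines with r integer registers and one finite-range
-- auxiliary variable with values in Fin (suc m) (a tuple of finitely many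
-- finite-range variables is encoded as a single finite-range variable).

data Rel : Set where
  lt eq gt ne le ge : Rel

evalRel : Rel → ℤ → ℤ → Bool
evalRel lt a b = does (a ℤ.<? b)
evalRel eq a b = does (a ℤ.≟ b)
evalRel gt a b = does (b ℤ.<? a)
evalRel ne a b = Data.Bool.not (does (a ℤ.≟ b))
evalRel le a b = does (a ℤ.≤? b)
evalRel ge a b = does (b ℤ.≤? a)

data Cond (r m : ℕ) : Set where
  cmpReg   : Rel → Fin r → Fin r → Cond r m
  cmpConst : Rel → Fin r → ℤ → Cond r m
  testVar  : Fin (suc m) → Cond r m

-- Commands (each execution of a command is one step).
data Instr (r m : ℕ) : Set where
  addReg   : Fin r → Fin r → Fin r → Instr r m
  addConst : Fin r → Fin r → ℤ → Instr r m
  subReg   : Fin r → Fin r → Fin r → Instr r m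
  subConst : Fin r → Fin r → ℤ → Instr r m
  constSub : Fin r → ℤ → Fin r → Instr r m
  setConst : Fin r → ℤ → Instr r m
  read     : Fin r → Instr r m
  write    : Fin r → Instr r m
  ifThenElse : Cond r m → Instr r m → Instr r m → Instr r m
  goto     : ℕ → Instr r m
  setVar   : Fin (suc m) → Instr r m

record Program (r : ℕ) : Set where
  constructor program
  field
    m    : ℕ
    code : List (Instr r m)

record Config (r m : ℕ) : Set where
  constructor config
  field
    pc     : ℕ
    regs   : Fin r → ℤ
    var    : Fin (suc m)
    input  : List ℤ
    output : List ℤ         -- integers written so far (most recent first)

open Config public

nth : ∀ {A : Set} → List A → ℕ → Maybe A
nth []       _       = nothing
nth (a ∷ _)  zero    = just a
nth (_ ∷ as) (suc n) = nth as n

setReg : ∀ {r} → (Fin r → ℤ) → Fin r → ℤ → (Fin r → ℤ)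
setReg ρ x v y = if does (y ≟ x) then v else ρ y

evalCond : ∀ {r m} → Cond r m → Config r m → Bool
evalCond (cmpReg R x y)   c = evalRel R (regs c x) (regs c y)
evalCond (cmpConst R x k) c = evalRel R (regs c x) k
evalCond (testVar v)      c = does (var c ≟ v)

assign : ∀ {r m} → Config r m → Fin r → ℤ → Config r m
assign (config p ρ v i o) x a = config (suc p) (setReg ρ x a) v i o

exec : ∀ {r m} → Instr r m → Config r m → Maybe (Config r m)
exec (addReg x y z)   c = just (assign c x (regs c y ℤ.+ regs c z))
exec (addConst x y k) c = just (assign c x (regs c y ℤ.+ k))
exec (subReg x y z)   c = just (assign c x (regs c y ℤ.- regs c z))
exec (subConst x y k) c = just (assign c x (regs c y ℤ.- k))
exec (constSub x k y) c = just (assign c x (k ℤ.- regs c y))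
exec (setConst x k)   c = just (assign c x k)
exec (read x) (config p ρ v [] o)      = nothing
exec (read x) (config p ρ v (a ∷ i) o) = just (config (suc p) (setReg ρ x a) v i o)
exec (write x) (config p ρ v i o)      = just (config (suc p) ρ v i (ρ x ∷ o))
exec (ifThenElse C I₁ I₂) c = if evalCond C c then exec I₁ c else exec I₂ c
exec (goto ℓ) (config p ρ v i o)       = just (config ℓ ρ v i o)
exec (setVar w) (config p ρ v i o)     = just (config (suc p) ρ w i o)

-- One step: `nothing` if the machine has halted (pc beyond the last line)
-- or is stuck.
step : ∀ {r} (P : Program r) → Config r (Program.m P) → Maybe (Config r (Program.m P))
step P c with nth (Program.code P) (pc c)
... | nothing = nothing
... | just I  = exec I c

steps : ∀ {r} (P : Program r) → ℕ → Config r (Program.m P) → Maybe (Config r (Program.m P))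
steps P zero    c = just c
steps P (suc t) c with step P c
... | nothing = nothing
... | just c' = steps P t c'

Halted : ∀ {r} (P : Program r) → Config r (Program.m P) → Set
Halted P c = nth (Program.code P) (pc c) ≡ nothing

initial : ∀ {r} (P : Program r) → List ℤ → Config r (Program.m P)
initial P inp = config 0 (λ _ → + 0) Fin.zero inp []

HaltsWith : ∀ {r} (P : Program r) → List ℤ → ℕ → List ℤ → Set
HaltsWith P inp t out =
  Σ (Config _ (Program.m P)) λ c →
    steps P t (initial P inp) ≡ just c × Halted P c × output c ≡ out

BinaryExponents : ℕ → List ℕ → Set
BinaryExponents x E = Unique E × x ≡ sum (map (2 ^_) E)

-- number of binary digits of x (0 has no digits; any fixed convention
-- for 0 is irrelevant to an O(n) bound with additive constant).
binDigits : ℕ → ℕ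
binDigits zero    = zero
binDigits (suc k) = suc ⌊log₂ (suc k) ⌋

{-# OPTIONS --safe #-}
module Submission where

-- With only additions and comparisons, the bit of a k-bit number v that can be read off in
-- constant time is the top one: double v and compare with P = 2^k, subtracting P if it is
-- reached. The machine first doubles P from 1 until P > x, which takes k ≤ n rounds. It then
-- reads x from the top while adding Q = 2^0, 2^1, … into R for each 1, so that R holds x with
-- its k bits reversed. Finally it reads R from the top, i.e. x from the bottom, while Q again
-- runs through 2^0, 2^1, …, and writes Q whenever the bit is 1. The three loops take 3, 6 and
-- 6 steps per round, 15k + 7 steps in all.

open import Defs
open import Data.Nat
  using (ℕ; zero; suc; _+_; _*_; _∸_; _^_; _<_; _≤_; z≤n; s≤s; _<?_)
open import Data.Nat.Properties hiding (_≟_)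
open import Data.Nat.Tactic.RingSolver using (solve-∀)
open import Data.Nat.Logarithm using (⌊log₂_⌋; ⌊log₂⌋-mono-≤; ⌊log₂[2^n]⌋≡n)
open import Data.Nat.ListAction using (sum)
open import Data.Integer as ℤ using (ℤ; +_; +<+; +≤+)
import Data.Integer.Properties as ℤ
open import Data.Fin using (Fin; zero; suc; _≟_)
open import Data.List using (List; []; _∷_; map; length; reverse; _++_; [_])
open import Data.List.Properties using (length-++; unfold-reverse; reverse-involutive; length-reverse)
open import Data.List.Relation.Unary.All as All using (All; []; _∷_)
open import Data.List.Relation.Unary.AllPairs using ([]; _∷_)
open import Data.List.Relation.Unary.Unique.Propositional using (Unique)
open import Data.List.Relation.Binary.Permutation.Propositional using (_↭_; ↭-refl)
open import Data.Maybe using (just; nothing)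
open import Data.Maybe.Relation.Binary.Pointwise using (Pointwise; just; nothing; just-inv)
open import Data.Bool using (Bool; true; false; if_then_else_)
open import Data.Product using (Σ; ∃-syntax; _×_; _,_)
open import Relation.Nullary using (yes; no; does; contradiction)
open import Relation.Nullary.Decidable using (dec-true; dec-false)
open import Relation.Binary.PropositionalEquality hiding ([_])

module _ {r m : ℕ} where

  -- Register files are functions, so without function extensionality configurations can
  -- only be identified up to pointwise equality of their registers.
  infix 4 _≈_
  data _≈_ : Config r m → Config r m → Set where
    mk≈ : ∀ {p ρ ρ′ v i o o′} → ρ ≗ ρ′ → o ≡ o′ → config p ρ v i o ≈ config p ρ′ v i o′

  ≈-refl : ∀ {c} → c ≈ c
  ≈-refl = mk≈ (λ _ → refl) refl

  ≈-sym : ∀ {c d} → c ≈ d → d ≈ c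
  ≈-sym (mk≈ ρ≗ρ′ o≡o′) = mk≈ (λ i → sym (ρ≗ρ′ i)) (sym o≡o′)

  ≈-trans : ∀ {c d e} → c ≈ d → d ≈ e → c ≈ e
  ≈-trans (mk≈ ρ≗ρ′ o≡o′) (mk≈ ρ′≗ρ″ o′≡o″) =
    mk≈ (λ i → trans (ρ≗ρ′ i) (ρ′≗ρ″ i)) (trans o≡o′ o′≡o″)

  setReg-cong : ∀ {ρ ρ′ : Fin r → ℤ} x {a a′} → ρ ≗ ρ′ → a ≡ a′ → setReg ρ x a ≗ setReg ρ′ x a′
  setReg-cong x ρ≗ρ′ refl y with does (y ≟ x)
  ... | true  = refl
  ... | false = ρ≗ρ′ y

  evalCond-cong : ∀ (K : Cond r m) {c d} → c ≈ d → evalCond K c ≡ evalCond K d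
  evalCond-cong (cmpReg R x y)   (mk≈ ρ≗ρ′ _) = cong₂ (evalRel R) (ρ≗ρ′ x) (ρ≗ρ′ y)
  evalCond-cong (cmpConst R x k) (mk≈ ρ≗ρ′ _) = cong (λ a → evalRel R a k) (ρ≗ρ′ x)
  evalCond-cong (testVar w)      (mk≈ _ _)    = refl

  exec-cong : ∀ (I : Instr r m) {c d} → c ≈ d → Pointwise _≈_ (exec I c) (exec I d)
  exec-cong (addReg x y z) (mk≈ ρ≗ρ′ o≡o′) =
    just (mk≈ (setReg-cong x ρ≗ρ′ (cong₂ ℤ._+_ (ρ≗ρ′ y) (ρ≗ρ′ z))) o≡o′)
  exec-cong (addConst x y k) (mk≈ ρ≗ρ′ o≡o′) =
    just (mk≈ (setReg-cong x ρ≗ρ′ (cong (ℤ._+ k) (ρ≗ρ′ y))) o≡o′)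
  exec-cong (subReg x y z) (mk≈ ρ≗ρ′ o≡o′) =
    just (mk≈ (setReg-cong x ρ≗ρ′ (cong₂ ℤ._-_ (ρ≗ρ′ y) (ρ≗ρ′ z))) o≡o′)
  exec-cong (subConst x y k) (mk≈ ρ≗ρ′ o≡o′) =
    just (mk≈ (setReg-cong x ρ≗ρ′ (cong (ℤ._- k) (ρ≗ρ′ y))) o≡o′)
  exec-cong (constSub x k y) (mk≈ ρ≗ρ′ o≡o′) =
    just (mk≈ (setReg-cong x ρ≗ρ′ (cong (ℤ._-_ k) (ρ≗ρ′ y))) o≡o′)
  exec-cong (setConst x k) (mk≈ ρ≗ρ′ o≡o′) = just (mk≈ (setReg-cong x ρ≗ρ′ refl) o≡o′)
  exec-cong (read x) (mk≈ {i = []}    _    _)     = nothing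
  exec-cong (read x) (mk≈ {i = _ ∷ _} ρ≗ρ′ o≡o′) = just (mk≈ (setReg-cong x ρ≗ρ′ refl) o≡o′)
  exec-cong (write x) (mk≈ ρ≗ρ′ o≡o′) = just (mk≈ ρ≗ρ′ (cong₂ _∷_ (ρ≗ρ′ x) o≡o′))
  exec-cong (ifThenElse K I J) {c} {d} c≈d
    with evalCond K c | evalCond K d | evalCond-cong K c≈d
  ... | true  | .true  | refl = exec-cong I c≈d
  ... | false | .false | refl = exec-cong J c≈d
  exec-cong (goto ℓ)   (mk≈ ρ≗ρ′ o≡o′) = just (mk≈ ρ≗ρ′ o≡o′)
  exec-cong (setVar w) (mk≈ ρ≗ρ′ o≡o′) = just (mk≈ ρ≗ρ′ o≡o′)

module Execution {r : ℕ} (M : Program r) where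

  open Program M using (m; code)

  step-cong : ∀ {c d : Config r m} → c ≈ d → Pointwise _≈_ (step M c) (step M d)
  step-cong {c} c≈d@(mk≈ _ _) with nth code (pc c)
  ... | nothing = nothing
  ... | just I  = exec-cong I c≈d

  steps-cong : ∀ t {c d : Config r m} → c ≈ d → Pointwise _≈_ (steps M t c) (steps M t d)
  steps-cong zero    c≈d = just c≈d
  steps-cong (suc t) {c} {d} c≈d with step M c | step M d | step-cong c≈d
  ... | just _  | just _  | just c′≈d′ = steps-cong t c′≈d′
  ... | nothing | nothing | nothing    = nothing

  steps-+ : ∀ s t {c e : Config r m} → steps M s c ≡ just e → steps M (s + t) c ≡ steps M t e
  steps-+ zero    t refl = refl
  steps-+ (suc s) t {c} c↝e with step M c
  ... | just c′ = steps-+ s t c↝e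

  record Reaches (c : Config r m) (t : ℕ) (d : Config r m) : Set where
    constructor reaching
    field
      {final} : Config r m
      runs    : steps M t c ≡ just final
      final≈  : final ≈ d

  ≈⇒reaches : ∀ {c d} → c ≈ d → Reaches c 0 d
  ≈⇒reaches c≈d = reaching refl c≈d

  step⇒reaches : ∀ {c e d} → step M c ≡ just e → e ≈ d → Reaches c 1 d
  step⇒reaches {c} c↦e e≈d = reaching (steps-1 c↦e) e≈d
    where
    steps-1 : ∀ {e} → step M c ≡ just e → steps M 1 c ≡ just e
    steps-1 c↦e with step M c | c↦e
    ... | just _ | refl = refl

  reaches-≈ : ∀ {c t d d′} → Reaches c t d → d ≈ d′ → Reaches c t d′
  reaches-≈ (reaching c↝e e≈d) d≈d′ = reaching c↝e (≈-trans e≈d d≈d′)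

  reaches-resp-time : ∀ {c s t d} → s ≡ t → Reaches c s d → Reaches c t d
  reaches-resp-time refl c↝d = c↝d

  infixr 5 _⨾_
  _⨾_ : ∀ {c d f s t} → Reaches c s d → Reaches d t f → Reaches c (s + t) f
  _⨾_ {s = s} {t} (reaching {e} c↝e e≈d) (reaching d↝g g≈f)
    with just-inv (subst (λ u → Pointwise _≈_ u (steps M t e)) d↝g (steps-cong t (≈-sym e≈d)))
  ... | _ , e↝g′ , g≈g′ = reaching (trans (steps-+ s t c↝e) e↝g′) (≈-trans (≈-sym g≈g′) g≈f)

  reaches⇒haltsWith : ∀ {inp t d} → Reaches (initial M inp) t d → Halted M d →
                      HaltsWith M inp t (output d)
  reaches⇒haltsWith (reaching ↝e (mk≈ _ o≡o′)) halted = _ , ↝e , halted , o≡o′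

msbValue : List Bool → ℕ
msbValue []           = 0
msbValue (false ∷ bs) = msbValue bs
msbValue (true ∷ bs)  = 2 ^ length bs + msbValue bs

lsbValue : List Bool → ℕ
lsbValue []           = 0
lsbValue (false ∷ bs) = 2 * lsbValue bs
lsbValue (true ∷ bs)  = 1 + 2 * lsbValue bs

msbValue<2^length : ∀ bs → msbValue bs < 2 ^ length bs
msbValue<2^length []           = s≤s z≤n
msbValue<2^length (false ∷ bs) = m≤n⇒m≤n+o (2 ^ length bs + 0) (msbValue<2^length bs)
msbValue<2^length (true ∷ bs)  =
  +-monoʳ-< (2 ^ length bs) (m≤n⇒m≤n+o 0 (msbValue<2^length bs))

msbValue-++ : ∀ bs cs → msbValue (bs ++ cs) ≡ msbValue bs * 2 ^ length cs + msbValue cs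
msbValue-++ []           cs = refl
msbValue-++ (false ∷ bs) cs = msbValue-++ bs cs
msbValue-++ (true ∷ bs)  cs = begin
  2 ^ length (bs ++ cs) + msbValue (bs ++ cs)
    ≡⟨ cong₂ _+_ (cong (2 ^_) (length-++ bs)) (msbValue-++ bs cs) ⟩
  2 ^ (length bs + length cs) + (msbValue bs * 2 ^ length cs + msbValue cs)
    ≡⟨ cong (_+ (msbValue bs * 2 ^ length cs + msbValue cs)) (^-distribˡ-+-* 2 (length bs) (length cs)) ⟩
  2 ^ length bs * 2 ^ length cs + (msbValue bs * 2 ^ length cs + msbValue cs)
    ≡⟨ +-assoc (2 ^ length bs * 2 ^ length cs) (msbValue bs * 2 ^ length cs) (msbValue cs) ⟨
  2 ^ length bs * 2 ^ length cs + msbValue bs * 2 ^ length cs + msbValue cs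
    ≡⟨ cong (_+ msbValue cs) (*-distribʳ-+ (2 ^ length cs) (2 ^ length bs) (msbValue bs)) ⟨
  (2 ^ length bs + msbValue bs) * 2 ^ length cs + msbValue cs ∎
  where open ≡-Reasoning

msbValue-reverse : ∀ bs → msbValue (reverse bs) ≡ lsbValue bs
msbValue-reverse []       = refl
msbValue-reverse (b ∷ bs) = begin
  msbValue (reverse (b ∷ bs))                 ≡⟨ cong msbValue (unfold-reverse b bs) ⟩
  msbValue (reverse bs ++ [ b ])              ≡⟨ msbValue-++ (reverse bs) [ b ] ⟩
  msbValue (reverse bs) * 2 + msbValue [ b ]
    ≡⟨ cong (λ v → v * 2 + msbValue [ b ]) (msbValue-reverse bs) ⟩
  lsbValue bs * 2 + msbValue [ b ]            ≡⟨ append-bit b ⟩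
  lsbValue (b ∷ bs)                           ∎
  where
  open ≡-Reasoning
  append-bit : ∀ b → lsbValue bs * 2 + msbValue [ b ] ≡ lsbValue (b ∷ bs)
  append-bit false = trans (+-identityʳ _) (*-comm (lsbValue bs) 2)
  append-bit true  = trans (+-comm _ 1) (cong suc (*-comm (lsbValue bs) 2))

lsbValue-reverse : ∀ bs → lsbValue (reverse bs) ≡ msbValue bs
lsbValue-reverse bs = trans (sym (msbValue-reverse (reverse bs))) (cong msbValue (reverse-involutive bs))

msbValue-onto : ∀ k {x} → x < 2 ^ k → ∃[ bs ] length bs ≡ k × msbValue bs ≡ x
msbValue-onto zero    {zero}  _           = [] , refl , refl
msbValue-onto zero    {suc _} (s≤s ())
msbValue-onto (suc k) {x} x<2^[1+k] with x <? 2 ^ k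
... | yes x<2^k with msbValue-onto k x<2^k
...   | bs , refl , refl = false ∷ bs , refl , refl
msbValue-onto (suc k) {x} x<2^[1+k] | no x≮2^k with msbValue-onto k x∸2^k<2^k
  where
  x∸2^k<2^k : x ∸ 2 ^ k < 2 ^ k
  x∸2^k<2^k = m<n+o⇒m∸n<o x (2 ^ k) {{m^n≢0 2 k}}
                (subst (x <_) (cong (_+_ (2 ^ k)) (+-identityʳ (2 ^ k))) x<2^[1+k])
...   | bs , refl , msbValue≡ =
  true ∷ bs , refl , trans (cong (_+_ (2 ^ length bs)) msbValue≡) (m+[n∸m]≡n (≮⇒≥ x≮2^k))

n+n≡2*n : ∀ n → n + n ≡ 2 * n
n+n≡2*n = solve-∀

m*n+m*n≡m*[2*n] : ∀ m n → m * n + m * n ≡ m * (2 * n)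
m*n+m*n≡m*[2*n] = solve-∀

2^l*2^[1+j]≡2^[j+1+l] : ∀ j l → 2 ^ l * 2 ^ suc j ≡ 2 ^ (j + suc l)
2^l*2^[1+j]≡2^[j+1+l] j l = begin
  2 ^ l * 2 ^ suc j ≡⟨ *-comm (2 ^ l) (2 ^ suc j) ⟩
  2 ^ suc j * 2 ^ l ≡⟨ ^-distribˡ-+-* 2 (suc j) l ⟨
  2 ^ (suc j + l)   ≡⟨ cong (2 ^_) (+-suc j l) ⟨
  2 ^ (j + suc l)   ∎
  where open ≡-Reasoning

2^j≡2^[j+0] : ∀ j → 2 ^ j ≡ 2 ^ (j + 0)
2^j≡2^[j+0] j = cong (2 ^_) (sym (+-identityʳ j))

2^j<2^[j+1+l] : ∀ j l → 2 ^ j < 2 ^ (j + suc l)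
2^j<2^[j+1+l] j l = ^-monoʳ-< 2 (s≤s (s≤s z≤n)) (m<m+n j (s≤s z≤n))

shift-out-false : ∀ bs j → let v = msbValue (false ∷ bs) * 2 ^ j in
                  v + v < 2 ^ (j + suc (length bs)) × v + v ≡ msbValue bs * 2 ^ suc j
shift-out-false bs j = subst (_< 2 ^ (j + suc (length bs))) (sym v+v≡) v+v< , v+v≡
  where
  v+v≡ = m*n+m*n≡m*[2*n] (msbValue bs) (2 ^ j)
  v+v< : msbValue bs * 2 ^ suc j < 2 ^ (j + suc (length bs))
  v+v< = subst (msbValue bs * 2 ^ suc j <_) (2^l*2^[1+j]≡2^[j+1+l] j (length bs))
           (*-monoˡ-< (2 ^ suc j) {{m^n≢0 2 (suc j)}} (msbValue<2^length bs))

shift-out-true : ∀ bs j → let v = msbValue (true ∷ bs) * 2 ^ j ; p = 2 ^ (j + suc (length bs)) in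
                 p ≤ v + v × v + v ∸ p ≡ msbValue bs * 2 ^ suc j
shift-out-true bs j = subst (p ≤_) (sym v+v≡) (m≤m+n p _) , trans (cong (_∸ p) v+v≡) (m+n∸m≡n p _)
  where
  open ≡-Reasoning
  l = length bs
  p = 2 ^ (j + suc l)
  v = (2 ^ l + msbValue bs) * 2 ^ j
  v+v≡ : v + v ≡ p + msbValue bs * 2 ^ suc j
  v+v≡ = begin
    v + v
      ≡⟨ m*n+m*n≡m*[2*n] (2 ^ l + msbValue bs) (2 ^ j) ⟩
    (2 ^ l + msbValue bs) * 2 ^ suc j
      ≡⟨ *-distribʳ-+ (2 ^ suc j) (2 ^ l) (msbValue bs) ⟩
    2 ^ l * 2 ^ suc j + msbValue bs * 2 ^ suc j
      ≡⟨ cong (_+ msbValue bs * 2 ^ suc j) (2^l*2^[1+j]≡2^[j+1+l] j l) ⟩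
    p + msbValue bs * 2 ^ suc j ∎

pushOnes : ℕ → List Bool → List ℕ → List ℕ
pushOnes j []           E = E
pushOnes j (false ∷ bs) E = pushOnes (suc j) bs E
pushOnes j (true ∷ bs)  E = pushOnes (suc j) bs (j ∷ E)

2^j*lsbValue-false : ∀ j bs → 2 ^ j * lsbValue (false ∷ bs) ≡ 2 ^ suc j * lsbValue bs
2^j*lsbValue-false j bs = q*[2*l]≡2*q*l (2 ^ j) (lsbValue bs)
  where
  q*[2*l]≡2*q*l : ∀ q l → q * (2 * l) ≡ 2 * q * l
  q*[2*l]≡2*q*l = solve-∀

2^j*lsbValue-true : ∀ j bs → 2 ^ j * lsbValue (true ∷ bs) ≡ 2 ^ j + 2 ^ suc j * lsbValue bs
2^j*lsbValue-true j bs = q*[1+2*l]≡q+2*q*l (2 ^ j) (lsbValue bs)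
  where
  q*[1+2*l]≡q+2*q*l : ∀ q l → q * (1 + 2 * l) ≡ q + 2 * q * l
  q*[1+2*l]≡q+2*q*l = solve-∀

sum-pushOnes : ∀ j bs E →
  sum (map (2 ^_) (pushOnes j bs E)) ≡ sum (map (2 ^_) E) + 2 ^ j * lsbValue bs
sum-pushOnes j [] E = sym (trans (cong (_+_ (sum (map (2 ^_) E))) (*-zeroʳ (2 ^ j))) (+-identityʳ _))
sum-pushOnes j (false ∷ bs) E =
  trans (sum-pushOnes (suc j) bs E) (cong (_+_ (sum (map (2 ^_) E))) (sym (2^j*lsbValue-false j bs)))
sum-pushOnes j (true ∷ bs) E = begin
  sum (map (2 ^_) (pushOnes (suc j) bs (j ∷ E)))
    ≡⟨ sum-pushOnes (suc j) bs (j ∷ E) ⟩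
  2 ^ j + s + 2 ^ suc j * lsbValue bs
    ≡⟨ cong (_+ 2 ^ suc j * lsbValue bs) (+-comm (2 ^ j) s) ⟩
  s + 2 ^ j + 2 ^ suc j * lsbValue bs
    ≡⟨ +-assoc s (2 ^ j) _ ⟩
  s + (2 ^ j + 2 ^ suc j * lsbValue bs)
    ≡⟨ cong (_+_ s) (2^j*lsbValue-true j bs) ⟨
  s + 2 ^ j * lsbValue (true ∷ bs) ∎
  where
  open ≡-Reasoning
  s = sum (map (2 ^_) E)

pushOnes-unique : ∀ j bs {E} → All (_< j) E → Unique E → Unique (pushOnes j bs E)
pushOnes-unique j []           E<j E! = E!
pushOnes-unique j (false ∷ bs) E<j E! = pushOnes-unique (suc j) bs (All.map m<n⇒m<1+n E<j) E!
pushOnes-unique j (true ∷ bs)  E<j E! =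
  pushOnes-unique (suc j) bs (n<1+n j ∷ All.map m<n⇒m<1+n E<j)
    (All.map (λ e<j e≡j → <-irrefl (sym e≡j) e<j) E<j ∷ E!)

pushOnes-binaryExponents : ∀ bs → BinaryExponents (msbValue bs) (pushOnes 0 (reverse bs) [])
pushOnes-binaryExponents bs =
  pushOnes-unique 0 (reverse bs) [] [] ,
  sym (trans (sum-pushOnes 0 (reverse bs) []) (trans (*-identityˡ _) (lsbValue-reverse bs)))

x<2^binDigits : ∀ x → x < 2 ^ binDigits x
x<2^binDigits zero    = s≤s z≤n
x<2^binDigits (suc x) with suc x <? 2 ^ binDigits (suc x)
... | yes x<2^n = x<2^n
... | no  x≮2^n = contradiction
        (subst (_≤ ⌊log₂ suc x ⌋) (⌊log₂[2^n]⌋≡n (binDigits (suc x))) (⌊log₂⌋-mono-≤ (≮⇒≥ x≮2^n)))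
        (n≮n ⌊log₂ suc x ⌋)

if-true : ∀ {A : Set} {b} {x y : A} → b ≡ true → (if b then x else y) ≡ x
if-true refl = refl

if-false : ∀ {A : Set} {b} {x y : A} → b ≡ false → (if b then x else y) ≡ y
if-false refl = refl

lt-true : ∀ {a b} → a ℤ.< b → evalRel lt a b ≡ true
lt-true {a} {b} = dec-true (a ℤ.<? b)

lt-false : ∀ {a b} → b ℤ.≤ a → evalRel lt a b ≡ false
lt-false {a} {b} b≤a = dec-false (a ℤ.<? b) (λ a<b → ℤ.<⇒≱ a<b b≤a)

le-true : ∀ {a b} → a ℤ.≤ b → evalRel le a b ≡ true
le-true {a} {b} = dec-true (a ℤ.≤? b)

le-false : ∀ {a b} → b ℤ.< a → evalRel le a b ≡ false
le-false {a} {b} b<a = dec-false (a ℤ.≤? b) (ℤ.<⇒≱ b<a)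

+m-+n≡+[m∸n] : ∀ {m n} → n ≤ m → + m ℤ.- + n ≡ + (m ∸ n)
+m-+n≡+[m∸n] {m} {n} n≤m = trans (ℤ.m-n≡m⊖n m n) (ℤ.⊖-≥ n≤m)

X P R Q : Fin 4
X = zero
P = suc zero
R = suc (suc zero)
Q = suc (suc (suc zero))

powersOfTwo : Program 4
powersOfTwo = program 0
  ( read X
  ∷ setConst P (+ 1)
  ∷ ifThenElse (cmpReg lt X P) (goto 5) (goto 3)
  ∷ addReg P P P
  ∷ goto 2
  ∷ setConst Q (+ 1)
  ∷ ifThenElse (cmpReg le P Q) (goto 12) (goto 7)
  ∷ addReg X X X
  ∷ ifThenElse (cmpReg lt X P) (goto 9) (addReg R R Q)
  ∷ ifThenElse (cmpReg lt X P) (goto 10) (subReg X X P)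
  ∷ addReg Q Q Q
  ∷ goto 6
  ∷ setConst Q (+ 1)
  ∷ ifThenElse (cmpReg le P Q) (goto 19) (goto 14)
  ∷ addReg R R R
  ∷ ifThenElse (cmpReg lt R P) (goto 16) (write Q)
  ∷ ifThenElse (cmpReg lt R P) (goto 17) (subReg R R P)
  ∷ addReg Q Q Q
  ∷ goto 13
  ∷ [])

open Execution powersOfTwo

registers : ℕ → ℕ → ℕ → ℕ → Fin 4 → ℤ
registers x p r q zero                   = + x
registers x p r q (suc zero)             = + p
registers x p r q (suc (suc zero))       = + r
registers x p r q (suc (suc (suc zero))) = + q

at : ℕ → ℕ → ℕ → ℕ → ℕ → List ℤ → Config 4 0
at ℓ x p r q o = config ℓ (registers x p r q) zero [] o

at-cong : ∀ {ℓ x x′ p p′ r r′ q q′ o} → x ≡ x′ → p ≡ p′ → r ≡ r′ → q ≡ q′ →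
          at ℓ x p r q o ≈ at ℓ x′ p′ r′ q′ o
at-cong refl refl refl refl = ≈-refl

line : ∀ {c ℓ ρ o x p r q} → step powersOfTwo c ≡ just (config ℓ ρ zero [] o) →
       ρ X ≡ + x → ρ P ≡ + p → ρ R ≡ + r → ρ Q ≡ + q → Reaches c 1 (at ℓ x p r q o)
line c↦ ρX ρP ρR ρQ =
  step⇒reaches c↦ (mk≈ (λ { zero                   → ρX
                            ; (suc zero)             → ρP
                            ; (suc (suc zero))       → ρR
                            ; (suc (suc (suc zero))) → ρQ }) refl)

jump : ∀ {c d} → step powersOfTwo c ≡ just d → Reaches c 1 d
jump c↦d = step⇒reaches c↦d ≈-refl

module _ {x p r q : ℕ} {o : List ℤ} where

  search-double : p ≤ x → Reaches (at 2 x p r q o) 3 (at 2 x (p + p) r q o)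
  search-double p≤x =
    jump (if-false (lt-false (+≤+ p≤x))) ⨾
    line refl refl refl refl refl ⨾
    jump refl

  search-exit : x < p → Reaches (at 2 x p r q o) 1 (at 5 x p r q o)
  search-exit x<p = jump (if-true (lt-true (+<+ x<p)))

  reverse-enter : Reaches (at 5 x p r q o) 1 (at 6 x p r 1 o)
  reverse-enter = line refl refl refl refl refl

  reverse-skip : q < p → x + x < p → Reaches (at 6 x p r q o) 6 (at 6 (x + x) p r (q + q) o)
  reverse-skip q<p 2x<p =
    jump (if-false (le-false (+<+ q<p))) ⨾
    line refl refl refl refl refl ⨾
    jump (if-true (lt-true (+<+ 2x<p))) ⨾
    jump (if-true (lt-true (+<+ 2x<p))) ⨾
    line refl refl refl refl refl ⨾
    jump refl

  reverse-take : q < p → p ≤ x + x →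
                 Reaches (at 6 x p r q o) 6 (at 6 (x + x ∸ p) p (r + q) (q + q) o)
  reverse-take q<p p≤2x =
    jump (if-false (le-false (+<+ q<p))) ⨾
    line refl refl refl refl refl ⨾
    line (if-false (lt-false (+≤+ p≤2x))) refl refl refl refl ⨾
    line (if-false (lt-false (+≤+ p≤2x))) (+m-+n≡+[m∸n] p≤2x) refl refl refl ⨾
    line refl refl refl refl refl ⨾
    jump refl

  reverse-exit : p ≤ q → Reaches (at 6 x p r q o) 1 (at 12 x p r q o)
  reverse-exit p≤q = jump (if-true (le-true (+≤+ p≤q)))

  emit-enter : Reaches (at 12 x p r q o) 1 (at 13 x p r 1 o)
  emit-enter = line refl refl refl refl refl

  emit-skip : q < p → r + r < p → Reaches (at 13 x p r q o) 6 (at 13 x p (r + r) (q + q) o)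
  emit-skip q<p 2r<p =
    jump (if-false (le-false (+<+ q<p))) ⨾
    line refl refl refl refl refl ⨾
    jump (if-true (lt-true (+<+ 2r<p))) ⨾
    jump (if-true (lt-true (+<+ 2r<p))) ⨾
    line refl refl refl refl refl ⨾
    jump refl

  emit-write : q < p → p ≤ r + r →
               Reaches (at 13 x p r q o) 6 (at 13 x p (r + r ∸ p) (q + q) (+ q ∷ o))
  emit-write q<p p≤2r =
    jump (if-false (le-false (+<+ q<p))) ⨾
    line refl refl refl refl refl ⨾
    jump (if-false (lt-false (+≤+ p≤2r))) ⨾
    line (if-false (lt-false (+≤+ p≤2r))) refl refl (+m-+n≡+[m∸n] p≤2r) refl ⨾
    line refl refl refl refl refl ⨾
    jump refl

  emit-exit : p ≤ q → Reaches (at 13 x p r q o) 1 (at 19 x p r q o)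
  emit-exit p≤q = jump (if-true (le-true (+≤+ p≤q)))

search-loop : ∀ n j {x} → x < 2 ^ (j + n) →
  ∃[ k ] k ≤ n × x < 2 ^ (j + k) ×
          Reaches (at 2 x (2 ^ j) 0 0 []) (k * 3 + 1) (at 5 x (2 ^ (j + k)) 0 0 [])
search-loop n j {x} x<2^[j+n] with x <? 2 ^ j
... | yes x<2^j =
  0 , z≤n , subst (x <_) (2^j≡2^[j+0] j) x<2^j ,
  reaches-≈ (search-exit x<2^j) (at-cong refl (2^j≡2^[j+0] j) refl refl)
search-loop zero j {x} x<2^[j+0] | no x≮2^j =
  contradiction (subst (x <_) (sym (2^j≡2^[j+0] j)) x<2^[j+0]) x≮2^j
search-loop (suc n) j {x} x<2^[j+1+n] | no x≮2^j
  with search-loop n (suc j) (subst (λ e → x < 2 ^ e) (+-suc j n) x<2^[j+1+n])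
... | k , k≤n , x<2^[j+1+k] , searched =
  suc k , s≤s k≤n , subst (x <_) (cong (2 ^_) (sym (+-suc j k))) x<2^[j+1+k] ,
  (search-double (≮⇒≥ x≮2^j) ⨾
   ≈⇒reaches (at-cong refl (n+n≡2*n (2 ^ j)) refl refl) ⨾
   reaches-≈ searched (at-cong refl (cong (2 ^_) (sym (+-suc j k))) refl refl))

reverse-loop : ∀ bs j r p → p ≡ 2 ^ (j + length bs) →
  Reaches (at 6 (msbValue bs * 2 ^ j) p r (2 ^ j) []) (length bs * 6 + 1)
          (at 12 0 p (r + 2 ^ j * lsbValue bs) p [])
reverse-loop [] j r _ refl =
  reaches-≈ (reverse-exit (≤-reflexive (sym (2^j≡2^[j+0] j))))
            (at-cong refl refl (sym (trans (cong (_+_ r) (*-zeroʳ (2 ^ j))) (+-identityʳ r)))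
                     (2^j≡2^[j+0] j))
reverse-loop (false ∷ bs) j r _ refl with shift-out-false bs j
... | 2v<p , 2v≡ =
  reverse-skip (2^j<2^[j+1+l] j (length bs)) 2v<p ⨾
  ≈⇒reaches (at-cong 2v≡ refl refl (n+n≡2*n (2 ^ j))) ⨾
  reaches-≈ (reverse-loop bs (suc j) r _ (cong (2 ^_) (+-suc j (length bs))))
            (at-cong refl refl (cong (_+_ r) (sym (2^j*lsbValue-false j bs))) refl)
reverse-loop (true ∷ bs) j r _ refl with shift-out-true bs j
... | p≤2v , 2v∸p≡ =
  reverse-take (2^j<2^[j+1+l] j (length bs)) p≤2v ⨾
  ≈⇒reaches (at-cong 2v∸p≡ refl refl (n+n≡2*n (2 ^ j))) ⨾
  reaches-≈ (reverse-loop bs (suc j) (r + 2 ^ j) _ (cong (2 ^_) (+-suc j (length bs))))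
            (at-cong refl refl (trans (+-assoc r (2 ^ j) _) (cong (_+_ r) (sym (2^j*lsbValue-true j bs)))) refl)

outputs : List ℕ → List ℤ
outputs = map (λ e → + (2 ^ e))

emit-loop : ∀ bs j E p {x} → p ≡ 2 ^ (j + length bs) →
  Reaches (at 13 x p (msbValue bs * 2 ^ j) (2 ^ j) (outputs E)) (length bs * 6 + 1)
          (at 19 x p 0 p (outputs (pushOnes j bs E)))
emit-loop [] j E _ refl =
  reaches-≈ (emit-exit (≤-reflexive (sym (2^j≡2^[j+0] j)))) (at-cong refl refl refl (2^j≡2^[j+0] j))
emit-loop (false ∷ bs) j E _ refl with shift-out-false bs j
... | 2v<p , 2v≡ =
  emit-skip (2^j<2^[j+1+l] j (length bs)) 2v<p ⨾
  ≈⇒reaches (at-cong refl refl 2v≡ (n+n≡2*n (2 ^ j))) ⨾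
  emit-loop bs (suc j) E _ (cong (2 ^_) (+-suc j (length bs)))
emit-loop (true ∷ bs) j E _ refl with shift-out-true bs j
... | p≤2v , 2v∸p≡ =
  emit-write (2^j<2^[j+1+l] j (length bs)) p≤2v ⨾
  ≈⇒reaches (at-cong refl refl 2v∸p≡ (n+n≡2*n (2 ^ j))) ⨾
  emit-loop bs (suc j) (j ∷ E) _ (cong (2 ^_) (+-suc j (length bs)))

start : ∀ {x} → Reaches (initial powersOfTwo (+ x ∷ [])) 2 (at 2 x 1 0 0 [])
start = line refl refl refl refl refl ⨾ line refl refl refl refl refl

read-bits : ∀ bs →
  Reaches (at 5 (msbValue bs) (2 ^ length bs) 0 0 []) (length bs * 12 + 4)
          (at 19 0 (2 ^ length bs) 0 (2 ^ length bs) (outputs (pushOnes 0 (reverse bs) [])))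
read-bits bs = reaches-resp-time time
  (reverse-enter ⨾
   ≈⇒reaches (at-cong (sym (*-identityʳ (msbValue bs))) refl refl refl) ⨾
   reverse-loop bs 0 0 _ refl ⨾
   emit-enter ⨾
   ≈⇒reaches (at-cong refl refl lsbValue≡msbValue-reverse refl) ⨾
   emit-loop (reverse bs) 0 [] _ (cong (2 ^_) (sym (length-reverse bs))))
  where
  l = length bs
  lsbValue≡msbValue-reverse : 1 * lsbValue bs ≡ msbValue (reverse bs) * 1
  lsbValue≡msbValue-reverse =
    trans (*-identityˡ _) (trans (sym (msbValue-reverse bs)) (sym (*-identityʳ _)))
  time : 1 + (l * 6 + 1 + (1 + (length (reverse bs) * 6 + 1))) ≡ l * 12 + 4
  time = trans (cong (λ l′ → 1 + (l * 6 + 1 + (1 + (l′ * 6 + 1)))) (length-reverse bs)) (ring l)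
    where
    ring : ∀ l → 1 + (l * 6 + 1 + (1 + (l * 6 + 1))) ≡ l * 12 + 4
    ring = solve-∀

time-bound : ∀ {k n} → k ≤ n → 2 + (k * 3 + 1 + (k * 12 + 4)) ≤ 15 * n + 7
time-bound {k} {n} k≤n = begin
  2 + (k * 3 + 1 + (k * 12 + 4)) ≡⟨ ring k ⟩
  15 * k + 7                      ≤⟨ +-monoˡ-≤ 7 (*-monoʳ-≤ 15 k≤n) ⟩
  15 * n + 7                      ∎
  where
  open ≤-Reasoning
  ring : ∀ k → 2 + (k * 3 + 1 + (k * 12 + 4)) ≡ 15 * k + 7
  ring = solve-∀

powersOfTwo-correct : ∀ x → Σ ℕ λ t → Σ (List ℤ) λ out →
    HaltsWith powersOfTwo (+ x ∷ []) t out
    × Σ (List ℕ) (λ E → BinaryExponents x E × out ↭ outputs E)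
    × t ≤ 15 * binDigits x + 7
powersOfTwo-correct x with search-loop (binDigits x) 0 (x<2^binDigits x)
... | k , k≤n , x<2^k , searched with msbValue-onto k x<2^k
...   | bs , refl , refl =
  _ , _ , reaches⇒haltsWith (start ⨾ searched ⨾ read-bits bs) refl ,
  (pushOnes 0 (reverse bs) [] , pushOnes-binaryExponents bs , ↭-refl) ,
  time-bound k≤n

theorem6 : Σ (Program 4) λ P → Σ ℕ λ c → Σ ℕ λ d →
    (x : ℕ) → Σ ℕ λ t → Σ (List _) λ out →
    HaltsWith P (+ x ∷ []) t out
    × Σ (List ℕ) (λ E → BinaryExponents x E × out ↭ map (λ e → + (2 ^ e)) E)
    × t ≤ c * binDigits x + d
theorem6 = powersOfTwo , 15 , 7 , powersOfTwo-correct
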